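{- Let $\Theta$ be a signature, $\mathcal{L}\in StIL$, $(\mathcal{M},v)\in Str_\mathcal{L}(\Theta)$, and let $\approx$ be a congruence on $\mathcal{M}$; if the language of $\mathcal{L}$ includes $\equiv$, assume moreover that $\approx$ is an $\equiv$-congruence. Then: (1) $(\mathcal{M}_\approx,v)\in Str_\mathcal{L}(\Theta)$, where $\mathcal{M}_\approx$ has worlds $W$ and order $\prec$, domains $(A_\approx)_w=\{[a]_{\approx(w)}:a\in A_w\}$ with $[a]_{\approx(w)}=\{b\in A_w: a\mathrel{\approx(w)}b\}$, $(I_\approx)_w(P)=\{[\langle\bar a_m\rangle]_{\approx(w)}:\bar a_m\in I_w(P)\}$ for $P\in\Theta_m$ (classes taken componentwise), $(I_\approx)_w(c)=[I_w(c)]_{\approx(w)}$, and $(\mathbb{H}_\approx)_{wu}([a]_{\approx(w)})=[\mathbb{H}_{wu}(a)]_{\approx(u)}$ for $w\prec u$, $a\in A_w$. (2) The relation $B=\{\langle(w;\bar a_m),(w;[\bar a_m]_{\approx(w)})\rangle,\langle(w;[\bar a_m]_{\approx(w)}),(w;\bar a_m)\rangle : w\in W,\ m<\omega,\ \bar a_m\in A_w^m\}$ is an $\mathcal{L}$-asimulation both from $(\mathcal{M},v,\bar a_n)$ to $(\mathcal{M}_\approx,v,[\bar a_n]_{\approx(v)})$ and from $(\mathcal{M}_\approx,v,[\bar a_n]_{\approx(v)})$ to $(\mathcal{M},v,\bar a_n)$, for every $v\in W$, every $n<\omega$ and every $\bar a_n\in A_v^n$.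
   Context: A signature $\Theta$ consists of predicate letters of positive arities ($\Theta_m$ the $m$-ary ones) and individual constants; no function symbols. A (Kripke) $\Theta$-model is $\mathcal{M}=\langle W,\prec,\mathfrak{A},\mathbb{H}\rangle$: $W\neq\emptyset$; $\prec$ a partial order; $\mathfrak{A}_w=(A_w,I_w)$ a classical $\Theta$-structure for each $w$, with $A_w\cap A_u=\emptyset$ for $w\neq u$; homomorphisms $\mathbb{H}_{wu}:\mathfrak{A}_w\to\mathfrak{A}_u$ for $w\prec u$ with $\mathbb{H}_{ww}=id$, $\mathbb{H}_{wt}=\mathbb{H}_{ut}\circ\mathbb{H}_{wu}$; $\mathbb{A}=\bigcup_w A_w$. $[\mathcal{M},w]$ is the restriction to $\{u:w\prec u\}$; for fresh constants $\bar c_l$ and $\bar\alpha_l\in A_w^l$, $([\mathcal{M},w],\bar c_l/\bar\alpha_l)$ expands it with $c_i$ denoting $\mathbb{H}_{wu}(\alpha_i)$ at $u$. Standard logics: $StIL=\{\mathsf{IL},\mathsf{CD},\mathsf{IL}^\equiv,\mathsf{CD}^\equiv,\mathsf{In}^\equiv,\mathsf{Bi}^\equiv\}$, intuitionistic first-order logics with Kripke semantics (atoms true at $w$ iff true in $\mathfrak{A}_w$; $\to$ and $\forall$ quantify over all $u\succ w$ transporting values by $\mathbb{H}_{wu}$; $\exists$ ranges over $A_w$), in the language without equality ($\mathsf{IL},\mathsf{CD}$) or with $\equiv$ (true iff values equal), over respectively: all models; models with all $\mathbb{H}_{wu}$ surjective; all models; surjective; injective; bijective. $Str_\mathcal{L}(\Theta)$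 is the class of pointed $\Theta$-models $(\mathcal{M},v)$ with $\mathcal{M}$ in the class of $\mathcal{L}$. Congruence: a function $\approx:W\to 2^{\mathbb{A}\times\mathbb{A}}$ is a congruence on $\mathcal{M}$ iff interpreting a new binary predicate by $\approx(w)$ at each $w$ yields a $(\Theta\cup\{\approx\})$-model (in particular $\approx(w)\subseteq A_w\times A_w$ and it is preserved by the maps $\mathbb{H}_{wu}$) in which the intuitionistic sentences $\forall x(x\approx x)$, $\forall x,y(x\approx y\to y\approx x)$, $\forall x,y,z(x\approx y\wedge y\approx z\to x\approx z)$ and, for each $P\in\Theta_n$, $\forall\bar x_n,\bar y_n(\bigwedge_i x_i\approx y_i\to(P(\bar x_n)\leftrightarrow P(\bar y_n)))$ hold at every world. An $\equiv$-congruence is one for which $\approx(w)$ is the identity relation on $A_w$ for every $w$. Asimulations. Fix pairwise distinct constants $c_1,c_2,\dots\notin\Theta$. An $\mathcal{L}$-asimulation from $(\mathcal{M}_1,w_1,\bar a_n)$ to $(\mathcal{M}_2,w_2,\bar b_n)$ is a relation $A$ between pairs $(w;\bar\alpha_l)$ ($w\in W_i$) and $(u;\bar\beta_l)$ ($u\in W_j$), $\{i,j\}=\{1,2\}$, with $(w_1;\bar a_n)A(w_2;\bar b_n)$, such that whenever $(w;\bar\alpha_l)A(u;\bar\beta_l)$ with $\bar\alpha_l\in(A_i)_w^l,\bar\beta_l\in(A_j)_u^l$: atomic sentences of the language of $\mathcal{L}$ over $\Theta\cup\{c_1..c_l\}$ true at $w$ in $([\mathcal{M}_i,w],\bar c_l/\bar\alpha_l)$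 are true at $u$ in $([\mathcal{M}_j,u],\bar c_l/\bar\beta_l)$; if $u\prec_j t$ some $s\succ_i w$ has $(s;\mathbb{H}_{ws}\langle\bar\alpha\rangle)A(t;\mathbb{H}_{ut}\langle\bar\beta\rangle)$ and $(t;\mathbb{H}_{ut}\langle\bar\beta\rangle)A(s;\mathbb{H}_{ws}\langle\bar\alpha\rangle)$; each $\alpha'\in(A_i)_w$ has $\beta'\in(A_j)_u$ with $(w;\bar\alpha{}^\frown\alpha')A(u;\bar\beta{}^\frown\beta')$; each $t\succ_j u$ and $\beta'\in(A_j)_t$ have $s\succ_i w$, $\alpha'\in(A_i)_s$ with $(s;\mathbb{H}_{ws}\langle\bar\alpha\rangle^\frown\alpha')A(t;\mathbb{H}_{ut}\langle\bar\beta\rangle^\frown\beta')$. -}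

module Defs where

open import Data.Nat using (ℕ; zero; suc; _+_; _≤_; s≤s; z≤n)
open import Data.Fin using (Fin; zero; suc; _↑ˡ_; _↑ʳ_)
open import Data.Vec using (Vec; []; _∷_; map; _∷ʳ_; lookup; tabulate)
open import Data.Product using (Σ; _×_; _,_)
open import Data.Sum using (_⊎_; inj₁; inj₂)
open import Data.Unit using (⊤; tt)
open import Data.Empty using (⊥)
open import Data.Bool using (Bool; true; false)
open import Relation.Binary.PropositionalEquality using (_≡_)
open import Relation.Binary.Structures using (IsPartialOrder)

record Signature : Set₁ where
  field
    Pred      : Set
    arity     : Pred → ℕ
    arity-pos : ∀ P → 1 ≤ arity P
    Const     : Set

open Signature

-- Kripke Θ-structures (data only).  Domains are a W-indexed family of
-- types, so A_w and A_u are disjoint for w ≠ u by construction.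
-- The homomorphism H_{wu} is indexed by a proof of w ≺ u.

record Struct (Θ : Signature) : Set₁ where
  field
    W   : Set
    _≺_ : W → W → Set
    A   : W → Set
    IP  : ∀ w (P : Pred Θ) → Vec (A w) (arity Θ P) → Set
    IC  : ∀ w → Const Θ → A w
    H   : ∀ {w u} → w ≺ u → A w → A u

record IsModel {Θ : Signature} (M : Struct Θ) : Set where
  open Struct M
  field
    po      : IsPartialOrder _≡_ _≺_
    H-id    : ∀ {w} (p : w ≺ w) (a : A w) → H p a ≡ a
    H-comp  : ∀ {w u t} (p : w ≺ u) (q : u ≺ t) (r : w ≺ t) (a : A w) →
              H r a ≡ H q (H p a)
    H-pred  : ∀ {w u} (p : w ≺ u) (P : Pred Θ) (as : Vec (A w) (arity Θ P)) →
              IP w P as → IP u P (map (H p) as)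
    H-const : ∀ {w u} (p : w ≺ u) (c : Const Θ) → H p (IC w c) ≡ IC u c

data Logic : Set where
  IL CD IL≡ CD≡ In≡ Bi≡ : Logic

hasEq : Logic → Bool
hasEq IL  = false
hasEq CD  = false
hasEq IL≡ = true
hasEq CD≡ = true
hasEq In≡ = true
hasEq Bi≡ = true

module _ {Θ : Signature} (M : Struct Θ) where
  open Struct M

  Surjective : Set
  Surjective = ∀ {w u} (p : w ≺ u) (b : A u) → Σ (A w) λ a → H p a ≡ b

  Injective : Set
  Injective = ∀ {w u} (p : w ≺ u) (a a' : A w) → H p a ≡ H p a' → a ≡ a'

ClassOf : Logic → ∀ {Θ} → Struct Θ → Set
ClassOf IL  M = ⊤
ClassOf CD  M = Surjective M
ClassOf IL≡ M = ⊤
ClassOf CD≡ M = Surjective M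
ClassOf In≡ M = Injective M
ClassOf Bi≡ M = Surjective M × Injective M

-- M (pointed at any world) belongs to Str_L(Θ)
InStr : Logic → ∀ {Θ} → Struct Θ → Set
InStr L M = IsModel M × ClassOf L M

-- First-order intuitionistic formulas (variables as de Bruijn indices,
-- the most recently bound variable is var zero) and Kripke forcing.

data Term (Θ : Signature) (k : ℕ) : Set where
  con : Const Θ → Term Θ k
  var : Fin k → Term Θ k

infixr 6 _∧'_
infixr 5 _∨'_
infixr 4 _⇒'_
infix 7 _≐_

data Fm (Θ : Signature) (k : ℕ) : Set where
  atom  : (P : Pred Θ) → Vec (Term Θ k) (arity Θ P) → Fm Θ k
  _≐_   : Term Θ k → Term Θ k → Fm Θ k
  ⊥'    : Fm Θ k
  _∧'_  : Fm Θ k → Fm Θ k → Fm Θ k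
  _∨'_  : Fm Θ k → Fm Θ k → Fm Θ k
  _⇒'_  : Fm Θ k → Fm Θ k → Fm Θ k
  ∀'    : Fm Θ (suc k) → Fm Θ k
  ∃'    : Fm Θ (suc k) → Fm Θ k

⊤' : ∀ {Θ k} → Fm Θ k
⊤' = ⊥' ⇒' ⊥'

_⇔'_ : ∀ {Θ k} → Fm Θ k → Fm Θ k → Fm Θ k
φ ⇔' ψ = (φ ⇒' ψ) ∧' (ψ ⇒' φ)

⋀ : ∀ {Θ k m} → Vec (Fm Θ k) m → Fm Θ k
⋀ []            = ⊤'
⋀ (φ ∷ [])      = φ
⋀ (φ ∷ ψ ∷ φs)  = φ ∧' ⋀ (ψ ∷ φs)

∀ⁿ : ∀ {Θ k} (n : ℕ) → Fm Θ (n + k) → Fm Θ k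
∀ⁿ zero    φ = φ
∀ⁿ (suc n) φ = ∀ⁿ n (∀' φ)

module Forcing {Θ : Signature} (M : Struct Θ) where
  open Struct M

  ⟦_⟧ : ∀ {k w} → Term Θ k → Vec (A w) k → A w
  ⟦_⟧ {w = w} (con c) ρ = IC w c
  ⟦ var i ⟧ ρ = lookup ρ i

  _⊩_[_] : ∀ {k} (w : W) → Fm Θ k → Vec (A w) k → Set
  w ⊩ atom P ts [ ρ ] = IP w P (map (λ t → ⟦ t ⟧ ρ) ts)
  w ⊩ s ≐ t     [ ρ ] = ⟦ s ⟧ ρ ≡ ⟦ t ⟧ ρ
  w ⊩ ⊥'        [ ρ ] = ⊥
  w ⊩ φ ∧' ψ    [ ρ ] = (w ⊩ φ [ ρ ]) × (w ⊩ ψ [ ρ ])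
  w ⊩ φ ∨' ψ    [ ρ ] = (w ⊩ φ [ ρ ]) ⊎ (w ⊩ ψ [ ρ ])
  w ⊩ φ ⇒' ψ    [ ρ ] = ∀ {u} (p : w ≺ u) →
                          u ⊩ φ [ map (H p) ρ ] → u ⊩ ψ [ map (H p) ρ ]
  w ⊩ ∀' φ      [ ρ ] = ∀ {u} (p : w ≺ u) (x : A u) → u ⊩ φ [ x ∷ map (H p) ρ ]
  w ⊩ ∃' φ      [ ρ ] = Σ (A w) λ x → w ⊩ φ [ x ∷ ρ ]

_+≈ : Signature → Signature
Pred      (Θ +≈) = Pred Θ ⊎ ⊤
arity     (Θ +≈) (inj₁ P) = arity Θ P
arity     (Θ +≈) (inj₂ _) = 2
arity-pos (Θ +≈) (inj₁ P) = arity-pos Θ P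
arity-pos (Θ +≈) (inj₂ _) = s≤s z≤n
Const     (Θ +≈) = Const Θ

Rel≈ : ∀ {Θ} → Struct Θ → Set₁
Rel≈ M = ∀ w → Struct.A M w → Struct.A M w → Set

expand : ∀ {Θ} (M : Struct Θ) → Rel≈ M → Struct (Θ +≈)
expand {Θ} M R = record
  { W = W ; _≺_ = _≺_ ; A = A ; IC = IC ; H = H ; IP = IP' }
  where
  open Struct M
  IP' : ∀ w (P : Pred (Θ +≈)) → Vec (A w) (arity (Θ +≈) P) → Set
  IP' w (inj₁ P) as = IP w P as
  IP' w (inj₂ _) as = R w (lookup as zero) (lookup as (suc zero))

module CongSentences (Θ : Signature) where
  infix 8 _≈'_
  _≈'_ : ∀ {k} → Term (Θ +≈) k → Term (Θ +≈) k → Fm (Θ +≈) k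
  s ≈' t = atom (inj₂ tt) (s ∷ t ∷ [])

  v0 : ∀ {k} → Term (Θ +≈) (suc k)
  v0 = var zero
  v1 : ∀ {k} → Term (Θ +≈) (suc (suc k))
  v1 = var (suc zero)
  v2 : ∀ {k} → Term (Θ +≈) (suc (suc (suc k)))
  v2 = var (suc (suc zero))

  reflS : Fm (Θ +≈) 0
  reflS = ∀' (v0 ≈' v0)

  -- ∀x ∀y (x ≈ y → y ≈ x)      (x = var 1, y = var 0)
  symS : Fm (Θ +≈) 0
  symS = ∀' (∀' (v1 ≈' v0 ⇒' v0 ≈' v1))

  transS : Fm (Θ +≈) 0
  transS = ∀' (∀' (∀' ((v2 ≈' v1 ∧' v1 ≈' v0) ⇒' v2 ≈' v0)))

  -- ∀x̄_n ∀ȳ_n (⋀_i x_i ≈ y_i → (P(x̄) ↔ P(ȳ)))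
  compatS : (P : Pred Θ) → Fm (Θ +≈) 0
  compatS P = ∀ⁿ n (∀ⁿ n (⋀ (tabulate (λ i → x i ≈' y i)) ⇒'
                  (atom (inj₁ P) (tabulate x) ⇔' atom (inj₁ P) (tabulate y))))
    where
    n = arity Θ P
    x : Fin n → Term (Θ +≈) (n + (n + 0))
    x i = var (i ↑ˡ (n + 0))
    y : Fin n → Term (Θ +≈) (n + (n + 0))
    y i = var (n ↑ʳ (i ↑ˡ 0))

IsCongruence : ∀ {Θ} (M : Struct Θ) → Rel≈ M → Set
IsCongruence {Θ} M R =
    IsModel (expand M R)
  × (∀ w → w ⊩ reflS  [ [] ])
  × (∀ w → w ⊩ symS   [ [] ])
  × (∀ w → w ⊩ transS [ [] ])
  × (∀ (P : Pred Θ) w → w ⊩ compatS P [ [] ])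
  where
  open Forcing (expand M R)
  open CongSentences Θ

IsEqCongruence : ∀ {Θ} (M : Struct Θ) → Rel≈ M → Set
IsEqCongruence M R = ∀ w (a b : Struct.A M w) → (R w a b → a ≡ b) × (a ≡ b → R w a b)

-- Agda (without cubical) has no quotient types, so the set of classes
-- {[a]_{≈(w)} : a ∈ A_w} is supplied as a quotient presentation:
-- a type Q w with the class map [_] = cls w, which is surjective (with
-- a chosen representative) and identifies exactly ≈(w)-related elements.

record QuotientOf {Θ} (M : Struct Θ) (R : Rel≈ M) : Set₁ where
  open Struct M
  field
    Q         : W → Set
    cls       : ∀ w → A w → Q w
    rep       : ∀ w → Q w → A w
    cls-rep   : ∀ w (x : Q w) → cls w (rep w x) ≡ x
    cls-sound : ∀ w (a b : A w) → R w a b → cls w a ≡ cls w b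
    cls-exact : ∀ w (a b : A w) → cls w a ≡ cls w b → R w a b

quotient : ∀ {Θ} (M : Struct Θ) {R : Rel≈ M} → QuotientOf M R → Struct Θ
quotient {Θ} M Qd = record
  { W = W ; _≺_ = _≺_ ; A = Q
  ; IP = λ w P xs → Σ (Vec (A w) (arity Θ P)) λ as → IP w P as × (map (cls w) as ≡ xs)
  ; IC = λ w c → cls w (IC w c)
  ; H  = λ {w} {u} p x → cls u (H p (rep w x))
  }
  where
  open Struct M
  open QuotientOf Qd

-- atomic sentences of the language of L over Θ ∪ {c_1..c_k}
-- (the new constant c_{i+1} is represented by var i)
data Atom (L : Logic) (Θ : Signature) (k : ℕ) : Set where
  atP  : (P : Pred Θ) → Vec (Term Θ k) (arity Θ P) → Atom L Θ k
  atEq : hasEq L ≡ true → Term Θ k → Term Θ k → Atom L Θ k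

atomFm : ∀ {L Θ k} → Atom L Θ k → Fm Θ k
atomFm (atP P ts)   = atom P ts
atomFm (atEq _ s t) = s ≐ t

PairRel : ∀ {Θ} → Struct Θ → Struct Θ → Set₁
PairRel M N = ∀ (w : Struct.W M) (u : Struct.W N) {l : ℕ} →
              Vec (Struct.A M w) l → Vec (Struct.A N u) l → Set

-- conditions on pairs (w;ᾱ) of Mi related to pairs (u;β̄) of Mj,
-- where R is the part of the relation going Mi → Mj and S the part Mj → Mi
AsimConds : (L : Logic) {Θ : Signature} (Mi Mj : Struct Θ) →
            PairRel Mi Mj → PairRel Mj Mi → Set
AsimConds L {Θ} Mi Mj R S =
  ∀ (w : I.W) (u : J.W) {l} (α : Vec (I.A w) l) (β : Vec (J.A u) l) → R w u α β →
      (∀ (φ : Atom L Θ l) → (w FI.⊩ atomFm φ [ α ]) → (u FJ.⊩ atomFm φ [ β ]))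
    × (∀ t (q : u J.≺ t) → Σ I.W λ s → Σ (w I.≺ s) λ p →
          R s t (map (I.H p) α) (map (J.H q) β) × S t s (map (J.H q) β) (map (I.H p) α))
    × (∀ (α' : I.A w) → Σ (J.A u) λ β' → R w u (α ∷ʳ α') (β ∷ʳ β'))
    × (∀ t (q : u J.≺ t) (β' : J.A t) → Σ I.W λ s → Σ (w I.≺ s) λ p → Σ (I.A s) λ α' →
          R s t (map (I.H p) α ∷ʳ α') (map (J.H q) β ∷ʳ β'))
  where
  module I = Struct Mi
  module J = Struct Mj
  module FI = Forcing Mi
  module FJ = Forcing Mj

-- The relation (R ∪ S) is an L-asimulation from (M1,w1,ā) to (M2,w2,b̄)
IsAsimulation : (L : Logic) {Θ : Signature} (M1 M2 : Struct Θ) →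
                PairRel M1 M2 → PairRel M2 M1 →
                (w1 : Struct.W M1) (w2 : Struct.W M2) {n : ℕ} →
                Vec (Struct.A M1 w1) n → Vec (Struct.A M2 w2) n → Set
IsAsimulation L M1 M2 R S w1 w2 a b =
  R w1 w2 a b × AsimConds L M1 M2 R S × AsimConds L M2 M1 S R

module _ {Θ} (M : Struct Θ) {R : Rel≈ M} (Qd : QuotientOf M R) where
  open Struct M
  open QuotientOf Qd

  data B→ : PairRel M (quotient M Qd) where
    mk : ∀ w {m} (as : Vec (A w) m) → B→ w w as (map (cls w) as)

  data B← : PairRel (quotient M Qd) M where
    mk : ∀ w {m} (as : Vec (A w) m) → B← w w (map (cls w) as) as

-- M_≈ is computed on representatives, and the choice of representative is
-- harmless because ≈ is preserved by the maps H_{wu} and respected by every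
-- predicate.  Hence M_≈ is again a model of the same kind, and the class map
-- a ↦ [a] commutes with H and transports atomic truth in both directions.
-- So B satisfies the back-and-forth conditions with the obvious witnesses:
-- the same world, and the class or a representative of the new element.
module Submission where

open import Defs
open import Data.Nat using (ℕ; zero; suc; _+_)
open import Data.Fin using (Fin; zero; suc; _↑ˡ_; _↑ʳ_)
open import Data.Vec using (Vec; map; []; _∷_; _++_; _∷ʳ_; lookup; tabulate)
open import Data.Vec.Properties
  using (map-cong; map-id; map-∘; map-∷ʳ; lookup-map; lookup-++ˡ; lookup-++ʳ;
         tabulate∘lookup; tabulate-∘; tabulate-cong)
open import Data.Bool using (true)
open import Data.Product using (_×_; _,_; proj₁; proj₂)
open import Data.Sum using (inj₁; inj₂)
open import Data.Unit using (tt)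
open import Function using (_∘_)
open import Relation.Binary.PropositionalEquality
  using (_≡_; refl; sym; trans; cong; cong₂; subst; subst₂; module ≡-Reasoning)
open import Relation.Binary.Structures using (IsPartialOrder)

module ForcingProperties {Θ : Signature} {M : Struct Θ} (isM : IsModel M) where
  open Struct M
  open IsModel isM
  open Forcing M

  ≺-refl : ∀ {w} → w ≺ w
  ≺-refl = IsPartialOrder.refl po

  map-H-refl : ∀ {w} (p : w ≺ w) {n} (ρ : Vec (A w) n) → map (H p) ρ ≡ ρ
  map-H-refl p ρ = trans (map-cong (H-id p) ρ) (map-id ρ)

  ⇒-elim : ∀ {w k} (φ ψ : Fm Θ k) (ρ : Vec (A w) k) →
           w ⊩ φ ⇒' ψ [ ρ ] → w ⊩ φ [ ρ ] → w ⊩ ψ [ ρ ]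
  ⇒-elim {w} φ ψ ρ φ⇒ψ φ-holds =
    subst (λ σ → w ⊩ ψ [ σ ]) (map-H-refl ≺-refl ρ)
      (φ⇒ψ ≺-refl (subst (λ σ → w ⊩ φ [ σ ]) (sym (map-H-refl ≺-refl ρ)) φ-holds))

  ∀ⁿ-elim : ∀ {w k} n (φ : Fm Θ (n + k)) (ρ : Vec (A w) k) →
            w ⊩ ∀ⁿ n φ [ ρ ] → (xs : Vec (A w) n) → w ⊩ φ [ xs ++ ρ ]
  ∀ⁿ-elim zero    φ ρ ∀φ []       = ∀φ
  ∀ⁿ-elim {w} (suc n) φ ρ ∀φ (x ∷ xs) =
    subst (λ σ → w ⊩ φ [ x ∷ σ ]) (map-H-refl ≺-refl (xs ++ ρ))
      (∀ⁿ-elim n (∀' φ) ρ ∀φ xs ≺-refl x)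

  ⋀-tabulate-intro : ∀ {w k} n (φs : Fin n → Fm Θ k) (ρ : Vec (A w) k) →
                     (∀ i → w ⊩ φs i [ ρ ]) → w ⊩ ⋀ (tabulate φs) [ ρ ]
  ⋀-tabulate-intro zero          φs ρ φs-hold = λ _ ()
  ⋀-tabulate-intro (suc zero)    φs ρ φs-hold = φs-hold zero
  ⋀-tabulate-intro (suc (suc n)) φs ρ φs-hold =
    φs-hold zero , ⋀-tabulate-intro (suc n) (φs ∘ suc) ρ (φs-hold ∘ suc)

module CongruenceProperties {Θ : Signature} {M : Struct Θ} {R : Rel≈ M}
                            (cng : IsCongruence M R) where
  open Struct M
  open Forcing (expand M R)
  open ForcingProperties (proj₁ cng)
  open CongSentences Θ

  ≈-preserved : ∀ {w u} (p : w ≺ u) {a b : A w} → R w a b → R u (H p a) (H p b)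
  ≈-preserved p {a} {b} = IsModel.H-pred (proj₁ cng) p (inj₂ tt) (a ∷ b ∷ [])

  IP-respects-≈ : ∀ {w} (P : Signature.Pred Θ) {as bs : Vec (A w) (Signature.arity Θ P)} →
                  (∀ i → R w (lookup as i) (lookup bs i)) → IP w P as → IP w P bs
  IP-respects-≈ {w} P {as} {bs} as≈bs P-as =
    subst (IP w P) (⟦tabulate⟧ bs ⟦y⟧)
      (⇒-elim Px Py ρ (proj₁ (⇒-elim x≈y (Px ⇔' Py) ρ compat-at-ρ pointwise-≈))
        (subst (IP w P) (sym (⟦tabulate⟧ as ⟦x⟧)) P-as))
    where
    n : ℕ
    n = Signature.arity Θ P
    -- the variables x_i, y_i of compatS P
    x y : Fin n → Term (Θ +≈) (n + (n + 0))
    x i = var (i ↑ˡ (n + 0))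
    y i = var (n ↑ʳ (i ↑ˡ 0))
    Px Py : Fm (Θ +≈) (n + (n + 0))
    Px = atom (inj₁ P) (tabulate x)
    Py = atom (inj₁ P) (tabulate y)
    x≈y : Fm (Θ +≈) (n + (n + 0))
    x≈y = ⋀ (tabulate (λ i → x i ≈' y i))
    ρ : Vec (A w) (n + (n + 0))
    ρ = as ++ (bs ++ [])

    ⟦x⟧ : ∀ i → ⟦ x i ⟧ ρ ≡ lookup as i
    ⟦x⟧ = lookup-++ˡ as (bs ++ [])
    ⟦y⟧ : ∀ i → ⟦ y i ⟧ ρ ≡ lookup bs i
    ⟦y⟧ i = trans (lookup-++ʳ as (bs ++ []) (i ↑ˡ 0)) (lookup-++ˡ bs [] i)

    ⟦tabulate⟧ : ∀ {z} (cs : Vec (A w) n) →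
                 (∀ i → ⟦ z i ⟧ ρ ≡ lookup cs i) → map (λ t → ⟦ t ⟧ ρ) (tabulate z) ≡ cs
    ⟦tabulate⟧ {z} cs ⟦z⟧ = begin
      map (λ t → ⟦ t ⟧ ρ) (tabulate z) ≡⟨ sym (tabulate-∘ (λ t → ⟦ t ⟧ ρ) z) ⟩
      tabulate (λ i → ⟦ z i ⟧ ρ)       ≡⟨ tabulate-cong ⟦z⟧ ⟩
      tabulate (lookup cs)             ≡⟨ tabulate∘lookup cs ⟩
      cs                               ∎
      where open ≡-Reasoning

    compat-at-ρ : w ⊩ x≈y ⇒' (Px ⇔' Py) [ ρ ]
    compat-at-ρ = ∀ⁿ-elim n _ (bs ++ [])
                    (∀ⁿ-elim n _ [] (proj₂ (proj₂ (proj₂ (proj₂ cng))) P w) bs) as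

    pointwise-≈ : w ⊩ x≈y [ ρ ]
    pointwise-≈ = ⋀-tabulate-intro n _ ρ
                    (λ i → subst₂ (R w) (sym (⟦x⟧ i)) (sym (⟦y⟧ i)) (as≈bs i))

module QuotientProperties {Θ : Signature} {M : Struct Θ} (isM : IsModel M)
                          {R : Rel≈ M} (cng : IsCongruence M R) (Qd : QuotientOf M R) where
  open Struct M
  open IsModel isM
  open QuotientOf Qd
  open CongruenceProperties cng
  private
    M≈ : Struct Θ
    M≈ = quotient M Qd
    module M≈ = Struct M≈
    module F = Forcing M
    module F≈ = Forcing M≈

  rep-cls : ∀ w (a : A w) → R w (rep w (cls w a)) a
  rep-cls w a = cls-exact w _ _ (cls-rep w (cls w a))

  H≈-cls : ∀ {w u} (p : w ≺ u) (a : A w) → M≈.H p (cls w a) ≡ cls u (H p a)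
  H≈-cls {w} {u} p a = cls-sound u _ _ (≈-preserved p (rep-cls w a))

  map-H≈-cls : ∀ {w u} (p : w ≺ u) {m} (as : Vec (A w) m) →
               map (M≈.H p) (map (cls w) as) ≡ map (cls u) (map (H p) as)
  map-H≈-cls {w} {u} p as = begin
    map (M≈.H p) (map (cls w) as)   ≡⟨ sym (map-∘ (M≈.H p) (cls w) as) ⟩
    map (M≈.H p ∘ cls w) as         ≡⟨ map-cong (H≈-cls p) as ⟩
    map (cls u ∘ H p) as            ≡⟨ map-∘ (cls u) (H p) as ⟩
    map (cls u) (map (H p) as)      ∎
    where open ≡-Reasoning

  quotient-isModel : IsModel M≈
  quotient-isModel = record
    { po      = po
    ; H-id    = λ {w} p x → trans (cong (cls w) (H-id p (rep w x))) (cls-rep w x)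
    ; H-comp  = λ {w} {u} {t} p q r x →
                  trans (cong (cls t) (H-comp p q r (rep w x))) (sym (H≈-cls q (H p (rep w x))))
    ; H-pred  = H≈-pred
    ; H-const = λ {w} {u} p c → trans (H≈-cls p (IC w c)) (cong (cls u) (H-const p c))
    }
    where
    H≈-pred : ∀ {w u} (p : w ≺ u) P (xs : Vec (M≈.A w) (Signature.arity Θ P)) →
              M≈.IP w P xs → M≈.IP u P (map (M≈.H p) xs)
    H≈-pred p P _ (as , P-as , refl) = map (H p) as , H-pred p P as P-as , sym (map-H≈-cls p as)

  quotient-surjective : Surjective M → Surjective M≈
  quotient-surjective onto {w} {u} p y with onto p (rep u y)
  ... | a , Ha≡y = cls w a , (begin
    M≈.H p (cls w a)   ≡⟨ H≈-cls p a ⟩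
    cls u (H p a)      ≡⟨ cong (cls u) Ha≡y ⟩
    cls u (rep u y)    ≡⟨ cls-rep u y ⟩
    y                  ∎)
    where open ≡-Reasoning

  -- For a coarser ≈, H_≈ may identify classes that H does not.
  quotient-injective : Injective M → IsEqCongruence M R → Injective M≈
  quotient-injective one-one R-is-≡ {w} {u} p x y Hx≡Hy = begin
    x                 ≡⟨ sym (cls-rep w x) ⟩
    cls w (rep w x)   ≡⟨ cong (cls w) (one-one p _ _ (proj₁ (R-is-≡ u _ _) (cls-exact u _ _ Hx≡Hy))) ⟩
    cls w (rep w y)   ≡⟨ cls-rep w y ⟩
    y                 ∎
    where open ≡-Reasoning

  quotient-classOf : ∀ L → ClassOf L M → (hasEq L ≡ true → IsEqCongruence M R) → ClassOf L M≈
  quotient-classOf IL  _                _   = tt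
  quotient-classOf CD  onto             _   = quotient-surjective onto
  quotient-classOf IL≡ _                _   = tt
  quotient-classOf CD≡ onto             _   = quotient-surjective onto
  quotient-classOf In≡ one-one          R-≡ = quotient-injective one-one (R-≡ refl)
  quotient-classOf Bi≡ (onto , one-one) R-≡ =
    quotient-surjective onto , quotient-injective one-one (R-≡ refl)

  ⟦⟧-cls : ∀ {w k} (t : Term Θ k) (as : Vec (A w) k) →
           F≈.⟦ t ⟧ (map (cls w) as) ≡ cls w (F.⟦ t ⟧ as)
  ⟦⟧-cls     (con c) as = refl
  ⟦⟧-cls {w} (var i) as = lookup-map i (cls w) as

  map-⟦⟧-cls : ∀ {w k m} (ts : Vec (Term Θ k) m) (as : Vec (A w) k) →
               map (cls w) (map (λ t → F.⟦ t ⟧ as) ts) ≡ map (λ t → F≈.⟦ t ⟧ (map (cls w) as)) ts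
  map-⟦⟧-cls ts as = trans (sym (map-∘ _ _ ts)) (map-cong (λ t → sym (⟦⟧-cls t as)) ts)

  cls-pointwise-exact : ∀ {w m} (as bs : Vec (A w) m) → map (cls w) as ≡ map (cls w) bs →
                        ∀ i → R w (lookup as i) (lookup bs i)
  cls-pointwise-exact {w} as bs [as]≡[bs] i = cls-exact w _ _ (begin
    cls w (lookup as i)        ≡⟨ sym (lookup-map i (cls w) as) ⟩
    lookup (map (cls w) as) i  ≡⟨ cong (λ cs → lookup cs i) [as]≡[bs] ⟩
    lookup (map (cls w) bs) i  ≡⟨ lookup-map i (cls w) bs ⟩
    cls w (lookup bs i)        ∎)
    where open ≡-Reasoning

  atom-to-quotient : ∀ {L w k} (φ : Atom L Θ k) (as : Vec (A w) k) →
                     w F.⊩ atomFm φ [ as ] → w F≈.⊩ atomFm φ [ map (cls w) as ]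
  atom-to-quotient     (atP P ts)   as P-ts = map (λ t → F.⟦ t ⟧ as) ts , P-ts , map-⟦⟧-cls ts as
  atom-to-quotient {w = w} (atEq _ s t) as s≡t =
    trans (⟦⟧-cls s as) (trans (cong (cls w) s≡t) (sym (⟦⟧-cls t as)))

  -- [s] = [t] only yields s ≈ t, hence the equality atoms need ≈ to be the identity.
  atom-from-quotient : ∀ {L} → (hasEq L ≡ true → IsEqCongruence M R) →
                       ∀ {w k} (φ : Atom L Θ k) (as : Vec (A w) k) →
                       w F≈.⊩ atomFm φ [ map (cls w) as ] → w F.⊩ atomFm φ [ as ]
  atom-from-quotient R-≡ {w} (atP P ts) as (bs , P-bs , [bs]≡[ts]) =
    IP-respects-≈ P (cls-pointwise-exact bs _ (trans [bs]≡[ts] (sym (map-⟦⟧-cls ts as)))) P-bs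
  atom-from-quotient R-≡ {w} (atEq hasEq s t) as [s]≡[t] =
    proj₁ (R-≡ hasEq w _ _) (cls-exact w _ _ (trans (sym (⟦⟧-cls s as)) (trans [s]≡[t] (⟦⟧-cls t as))))

  B→-by : ∀ w {m} (as : Vec (A w) m) {xs} → map (cls w) as ≡ xs → B→ M Qd w w as xs
  B→-by w as refl = mk w as

  B←-by : ∀ w {m} (as : Vec (A w) m) {xs} → map (cls w) as ≡ xs → B← M Qd w w xs as
  B←-by w as refl = mk w as

  B→-asimConds : ∀ L → AsimConds L M M≈ (B→ M Qd) (B← M Qd)
  B→-asimConds L w .w .as .(map (cls w) as) (mk .w as) =
      (λ φ → atom-to-quotient φ as)
    , (λ t q → t , q , B→-by t (map (H q) as) (sym (map-H≈-cls q as))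
                     , B←-by t (map (H q) as) (sym (map-H≈-cls q as)))
    , (λ a → cls w a , B→-by w (as ∷ʳ a) (map-∷ʳ (cls w) a as))
    , (λ t q y → t , q , rep t y , B→-by t (map (H q) as ∷ʳ rep t y) (begin
        map (cls t) (map (H q) as ∷ʳ rep t y)        ≡⟨ map-∷ʳ (cls t) (rep t y) (map (H q) as) ⟩
        map (cls t) (map (H q) as) ∷ʳ cls t (rep t y) ≡⟨ cong₂ _∷ʳ_ (sym (map-H≈-cls q as)) (cls-rep t y) ⟩
        map (M≈.H q) (map (cls w) as) ∷ʳ y            ∎))
    where open ≡-Reasoning

  B←-asimConds : ∀ L → (hasEq L ≡ true → IsEqCongruence M R) →
                 AsimConds L M≈ M (B← M Qd) (B→ M Qd)
  B←-asimConds L R-≡ w .w .(map (cls w) as) .as (mk .w as) =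
      (λ φ → atom-from-quotient R-≡ φ as)
    , (λ t q → t , q , B←-by t (map (H q) as) (sym (map-H≈-cls q as))
                     , B→-by t (map (H q) as) (sym (map-H≈-cls q as)))
    , (λ x → rep w x , B←-by w (as ∷ʳ rep w x)
                         (trans (map-∷ʳ (cls w) (rep w x) as) (cong (map (cls w) as ∷ʳ_) (cls-rep w x))))
    , (λ t q a → t , q , cls t a , B←-by t (map (H q) as ∷ʳ a)
                         (trans (map-∷ʳ (cls t) a (map (H q) as)) (cong (_∷ʳ cls t a) (sym (map-H≈-cls q as)))))

lemma4p7 : (Θ : Signature) (L : Logic) (M : Struct Θ) (v : Struct.W M) →
           InStr L M →
           (R : Rel≈ M) → IsCongruence M R →
           (hasEq L ≡ true → IsEqCongruence M R) →
           (Qd : QuotientOf M R) →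
           InStr L (quotient M Qd)
           × (∀ (v' : Struct.W M) (n : ℕ) (as : Vec (Struct.A M v') n) →
                IsAsimulation L M (quotient M Qd) (B→ M Qd) (B← M Qd)
                  v' v' as (map (QuotientOf.cls Qd v') as)
              × IsAsimulation L (quotient M Qd) M (B← M Qd) (B→ M Qd)
                  v' v' (map (QuotientOf.cls Qd v') as) as)
lemma4p7 Θ L M _ (isM , inClass) R cng R-≡ Qd =
    (quotient-isModel , quotient-classOf L inClass R-≡)
  , λ v n as → (mk v as , B→-asimConds L , B←-asimConds L R-≡)
              , (mk v as , B←-asimConds L R-≡ , B→-asimConds L)
  where open QuotientProperties isM cng Qd
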